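{- Let $h,n\ge 2$ and let $U\le G=S_h\times S_n$ be regular, and set $W(U)=\{g\in G: p^g\in p^U\ \forall p\in\mathcal P\}$. Then: (i) $O(U)\le W(U)\le G$ (in particular $W(U)$ is a subgroup); (ii) $W(U)$ is regular if and only if $W(U)=O(U)$; (iii) $U\cong_{\mathcal P}O(U)$; (iv) if $U\le S_h\times\{id\}$, then $W(U)\le S_h\times\{id\}$ and $W(U)=O(U)$; (v) $W(U)$ need not be regular, and hence need not equal $O(U)$: there exist a voting pair $(h,n)$ and a regular $U$ with $W(U)$ not regular.
   Context: $\mathcal P=(S_n)^h$, with $G$ acting by $p^{(\varphi,\psi)}$ having $i$-th component $\psi\,p_{\varphi^{ -1}(i)}$ (products are compositions); $p^U=\{p^u:u\in U\}$. $U\le G$ is regular if $\{u\in U:p^u=p\}\subseteq S_h\times\{id\}$ for all $p$. For $U,V\le G$: $V\le_{\mathcal P}U$ means $p^V\subseteq p^U$ for all $p$; $U\cong_{\mathcal P}V$ means $U\le_{\mathcal P}V$ and $V\le_{\mathcal P}U$. For regular $U$: $\mathcal A(U)=\{V\le G:V\text{ regular},V\ge U,V\le_{\mathcal P}U\}$ and $O(U)=\langle\mathcal A(U)\rangle$. -}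

module Defs where

open import Level using (Level; _⊔_; suc; 0ℓ)
open import Data.Nat using (ℕ)
open import Data.Fin using (Fin)
open import Data.Fin.Permutation
  using (Permutation′; _⟨$⟩ʳ_; _⟨$⟩ˡ_; _∘ₚ_; flip)
  renaming (id to idₚ; _≈_ to _≈ₚ_)
open import Data.Product using (Σ; _×_; _,_; proj₁; proj₂; ∃)
open import Relation.Binary.PropositionalEquality using (_≡_)

S : ℕ → Set
S k = Permutation′ k

G : ℕ → ℕ → Set
G h n = S h × S n

_≈G_ : ∀ {h n} → G h n → G h n → Set
(φ , ψ) ≈G (φ' , ψ') = (φ ≈ₚ φ') × (ψ ≈ₚ ψ')

-- identity, product (composition, "ψ ψ'" = ψ after ψ') and inverse in G
εG : ∀ {h n} → G h n
εG = idₚ , idₚ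

_·G_ : ∀ {h n} → G h n → G h n → G h n
(φ , ψ) ·G (φ' , ψ') = (φ' ∘ₚ φ) , (ψ' ∘ₚ ψ)

invG : ∀ {h n} → G h n → G h n
invG (φ , ψ) = flip φ , flip ψ

Profile : ℕ → ℕ → Set
Profile h n = Fin h → S n

_≈P_ : ∀ {h n} → Profile h n → Profile h n → Set
p ≈P q = ∀ i → p i ≈ₚ q i

-- action: (p^(φ,ψ))_i = ψ ∘ p_{φ⁻¹(i)}   (apply p_{φ⁻¹ i} first, then ψ)
_^_ : ∀ {h n} → Profile h n → G h n → Profile h n
(p ^ (φ , ψ)) i = p (φ ⟨$⟩ˡ i) ∘ₚ ψ

Sub : ∀ (ℓ : Level) → ℕ → ℕ → Set (suc ℓ)
Sub ℓ h n = G h n → Set ℓ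

record IsSubgroup {ℓ h n} (U : Sub ℓ h n) : Set ℓ where
  field
    resp : ∀ {g g'} → g ≈G g' → U g → U g'
    has-ε : U εG
    has-· : ∀ {g g'} → U g → U g' → U (g ·G g')
    has-inv : ∀ {g} → U g → U (invG g)

Regular : ∀ {ℓ h n} → Sub ℓ h n → Set ℓ
Regular {h = h} {n} U =
  ∀ (p : Profile h n) (u : G h n) → U u → (p ^ u) ≈P p → proj₂ u ≈ₚ idₚ

_⊆_ : ∀ {ℓ ℓ' h n} → Sub ℓ h n → Sub ℓ' h n → Set (ℓ ⊔ ℓ')
U ⊆ V = ∀ g → U g → V g

_≐_ : ∀ {ℓ ℓ' h n} → Sub ℓ h n → Sub ℓ' h n → Set (ℓ ⊔ ℓ')
U ≐ V = (U ⊆ V) × (V ⊆ U)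

_≤P_ : ∀ {ℓ ℓ' h n} → Sub ℓ h n → Sub ℓ' h n → Set (ℓ ⊔ ℓ')
_≤P_ {h = h} {n} V U =
  ∀ (p : Profile h n) (v : G h n) → V v → Σ (G h n) λ u → U u × ((p ^ v) ≈P (p ^ u))

_≅P_ : ∀ {ℓ ℓ' h n} → Sub ℓ h n → Sub ℓ' h n → Set (ℓ ⊔ ℓ')
U ≅P V = (U ≤P V) × (V ≤P U)

Sh×id : ∀ {h n} → Sub 0ℓ h n
Sh×id g = proj₂ g ≈ₚ idₚ

𝒜 : ∀ {h n} → Sub 0ℓ h n → Sub 0ℓ h n → Set
𝒜 U V = IsSubgroup V × Regular V × (U ⊆ V) × (V ≤P U)

data Gen {h n} (𝒜' : Sub 0ℓ h n → Set) : G h n → Set₁ where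
  base : ∀ (V : Sub 0ℓ h n) {g} → 𝒜' V → V g → Gen 𝒜' g
  gen-ε : Gen 𝒜' εG
  gen-· : ∀ {g g'} → Gen 𝒜' g → Gen 𝒜' g' → Gen 𝒜' (g ·G g')
  gen-inv : ∀ {g} → Gen 𝒜' g → Gen 𝒜' (invG g)
  gen-resp : ∀ {g g'} → g ≈G g' → Gen 𝒜' g → Gen 𝒜' g'

O : ∀ {h n} → Sub 0ℓ h n → Sub (suc 0ℓ) h n
O U = Gen (𝒜 U)

W : ∀ {h n} → Sub 0ℓ h n → Sub 0ℓ h n
W {h} {n} U g = ∀ (p : Profile h n) → Σ (G h n) λ u → U u × ((p ^ g) ≈P (p ^ u))

-- Call u ∈ U an imitation of g at p if p^g = p^u, so that W(U) is the set of g imitated by U at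
-- every profile.  The subgroup O(U) admits the same description, with the extra requirement that
-- g and its imitation act identically on the alternatives: this set is a regular subgroup lying
-- in 𝒜(U), and it contains every V ∈ 𝒜(U), because for v ∈ V imitated by u ∈ U at p the element
-- u⁻¹v ∈ V fixes p, so regularity of V forces v and u to agree on the alternatives.  For (v), take h = n = 2 and U = {id} × S₂: swapping both the two voters and
-- the two alternatives is imitated at every profile by U, yet fixes the profile (id, (0 1)).
module Submission where

open import Defs
open import Level using (0ℓ)
open import Data.Bool using (Bool; true; false)
open import Data.Fin using (Fin)
open import Data.Fin.Patterns using (0F; 1F)
open import Data.Fin.Properties using (all?) renaming (_≟_ to _≟ᶠ_)
open import Data.Fin.Permutation
  using (_⟨$⟩ʳ_; _⟨$⟩ˡ_; inverseˡ; inverseʳ; transpose)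
  renaming (id to idₚ; _≈_ to _≈ₚ_)
open import Data.Nat using (ℕ; _≤_; s≤s; z≤n)
open import Data.Product using (Σ; _×_; _,_; proj₁; proj₂; swap)
open import Data.Unit using (⊤; tt)
open import Function.Bundles using (_⇔_; mk⇔; Equivalence; Injection)
open import Function.Properties.Inverse using (↔⇒↣)
open import Relation.Binary using (Rel; Decidable; IsEquivalence; Setoid)
open import Relation.Binary.PropositionalEquality
  using (_≡_; refl; sym; trans; cong; module ≡-Reasoning)
import Relation.Binary.Reasoning.Setoid as SetoidReasoning
open import Relation.Nullary using (¬_)
open import Relation.Nullary.Decidable using (True; toWitness)
open import Relation.Nullary.Negation using (contradiction)

⟨$⟩ʳ-injective : ∀ {k} (π : S k) {i j : Fin k} → π ⟨$⟩ʳ i ≡ π ⟨$⟩ʳ j → i ≡ j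
⟨$⟩ʳ-injective π = Injection.injective (↔⇒↣ π)

⟨$⟩ˡ-cong : ∀ {k} (π ρ : S k) → π ≈ₚ ρ → ∀ i → π ⟨$⟩ˡ i ≡ ρ ⟨$⟩ˡ i
⟨$⟩ˡ-cong π ρ π≈ρ i = ⟨$⟩ʳ-injective π (begin
  π ⟨$⟩ʳ (π ⟨$⟩ˡ i)  ≡⟨ inverseʳ π ⟩
  i                   ≡⟨ inverseʳ ρ ⟨
  ρ ⟨$⟩ʳ (ρ ⟨$⟩ˡ i)  ≡⟨ π≈ρ _ ⟨
  π ⟨$⟩ʳ (ρ ⟨$⟩ˡ i)  ∎)
  where open ≡-Reasoning

module _ {h n : ℕ} where

  ≈P-isEquivalence : IsEquivalence (_≈P_ {h} {n})
  ≈P-isEquivalence = record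
    { refl  = λ _ _ → refl
    ; sym   = λ p≈q i x → sym (p≈q i x)
    ; trans = λ p≈q q≈r i x → trans (p≈q i x) (q≈r i x)
    }

  ≈P-setoid : Setoid 0ℓ 0ℓ
  ≈P-setoid = record { isEquivalence = ≈P-isEquivalence }

  _≈P?_ : Decidable (_≈P_ {h} {n})
  p ≈P? q = all? λ i → all? λ x → p i ⟨$⟩ʳ x ≟ᶠ q i ⟨$⟩ʳ x

  ^-congˡ : ∀ (p q : Profile h n) (g : G h n) → p ≈P q → (p ^ g) ≈P (q ^ g)
  ^-congˡ p q (φ , ψ) p≈q i x = cong (ψ ⟨$⟩ʳ_) (p≈q (φ ⟨$⟩ˡ i) x)

  ^-congʳ : ∀ (p : Profile h n) (g g' : G h n) → g ≈G g' → (p ^ g) ≈P (p ^ g')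
  ^-congʳ p (φ , ψ) (φ' , _) (φ≈φ' , ψ≈ψ') i x =
    trans (cong (λ j → ψ ⟨$⟩ʳ (p j ⟨$⟩ʳ x)) (⟨$⟩ˡ-cong φ φ' φ≈φ' i)) (ψ≈ψ' _)

  ^-· : ∀ (p : Profile h n) (g g' : G h n) → (p ^ (g ·G g')) ≈P ((p ^ g') ^ g)
  ^-· p g g' _ _ = refl

  ^-inv-^ : ∀ (p : Profile h n) (g : G h n) → ((p ^ invG g) ^ g) ≈P p
  ^-inv-^ p (φ , ψ) i x = trans (inverseʳ ψ) (cong (λ j → p j ⟨$⟩ʳ x) (inverseʳ φ))

  ^-^-inv : ∀ (p : Profile h n) (g : G h n) → ((p ^ g) ^ invG g) ≈P p
  ^-^-inv p (φ , ψ) i x = trans (inverseˡ ψ) (cong (λ j → p j ⟨$⟩ʳ x) (inverseˡ φ))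

  ^-≈P-transport : ∀ (p q : Profile h n) (g u : G h n) →
                   p ≈P q → (q ^ g) ≈P (q ^ u) → (p ^ g) ≈P (p ^ u)
  ^-≈P-transport p q g u p≈q qg≈qu = begin
    p ^ g   ≈⟨ ^-congˡ p q g p≈q ⟩
    q ^ g   ≈⟨ qg≈qu ⟩
    q ^ u   ≈⟨ ^-congˡ p q u p≈q ⟨
    p ^ u   ∎
    where open SetoidReasoning ≈P-setoid

  IsSubgroup-≐ : ∀ {ℓ ℓ'} {U : Sub ℓ h n} {V : Sub ℓ' h n} →
                 U ≐ V → IsSubgroup U → IsSubgroup V
  IsSubgroup-≐ (U⊆V , V⊆U) sU = record
    { resp    = λ g≈g' Vg → U⊆V _ (resp g≈g' (V⊆U _ Vg))
    ; has-ε   = U⊆V _ has-ε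
    ; has-·   = λ Vg Vg' → U⊆V _ (has-· (V⊆U _ Vg) (V⊆U _ Vg'))
    ; has-inv = λ Vg → U⊆V _ (has-inv (V⊆U _ Vg))
    }
    where open IsSubgroup sU

  Regular-⊆ : ∀ {ℓ ℓ'} {U : Sub ℓ h n} {V : Sub ℓ' h n} → V ⊆ U → Regular U → Regular V
  Regular-⊆ V⊆U rU p v Vv = rU p v (V⊆U v Vv)

  Sh×id-regular : Regular (Sh×id {h} {n})
  Sh×id-regular _ _ ψ≈id _ = ψ≈id

  ⊆⇒≤P : ∀ {ℓ ℓ'} {U : Sub ℓ h n} {V : Sub ℓ' h n} → V ⊆ U → V ≤P U
  ⊆⇒≤P V⊆U p v Vv = v , V⊆U v Vv , λ _ _ → refl

  ⊆-≤P-trans : ∀ {ℓ ℓ' ℓ''} {U : Sub ℓ h n} {V : Sub ℓ' h n} {V' : Sub ℓ'' h n} →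
               V ⊆ V' → V' ≤P U → V ≤P U
  ⊆-≤P-trans V⊆V' V'≤U p v Vv = V'≤U p v (V⊆V' v Vv)

  Gen-least : ∀ {ℓ} {𝒜' : Sub 0ℓ h n → Set} {V : Sub ℓ h n} →
              IsSubgroup V → (∀ X → 𝒜' X → X ⊆ V) → Gen 𝒜' ⊆ V
  Gen-least {𝒜' = 𝒜'} {V} sV X⊆V = least
    where
    open IsSubgroup sV

    least : Gen 𝒜' ⊆ V
    least _ (base X 𝒜'X Xg)  = X⊆V X 𝒜'X _ Xg
    least _ gen-ε             = has-ε
    least _ (gen-· a b)       = has-· (least _ a) (least _ b)
    least _ (gen-inv a)       = has-inv (least _ a)
    least _ (gen-resp g≈g' a) = resp g≈g' (least _ a)

  Imitated : Sub 0ℓ h n → Rel (G h n) 0ℓ → Sub 0ℓ h n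
  Imitated U _∼_ g = ∀ p → Σ (G h n) λ u → U u × (p ^ g) ≈P (p ^ u) × g ∼ u

  record IsCompatible (_∼_ : Rel (G h n) 0ℓ) : Set where
    field
      ∼-respˡ : ∀ {g g' u} → g ≈G g' → g ∼ u → g' ∼ u
      ∼-ε     : εG ∼ εG
      ∼-·     : ∀ {g g' u u'} → g ∼ u → g' ∼ u' → (g ·G g') ∼ (u ·G u')
      ∼-inv   : ∀ {g u} → g ∼ u → invG g ∼ invG u

  Imitated-isSubgroup : ∀ {U : Sub 0ℓ h n} {_∼_ : Rel (G h n) 0ℓ} →
                        IsSubgroup U → IsCompatible _∼_ → IsSubgroup (Imitated U _∼_)
  Imitated-isSubgroup {U} {_∼_} sU c = record
    { resp    = resp′
    ; has-ε   = λ p → εG , has-ε sU , (λ _ _ → refl) , ∼-ε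
    ; has-·   = has-·′
    ; has-inv = has-inv′
    }
    where
    open IsSubgroup
    open IsCompatible c
    open SetoidReasoning ≈P-setoid

    resp′ : ∀ {g g'} → g ≈G g' → Imitated U _∼_ g → Imitated U _∼_ g'
    resp′ {g} {g'} g≈g' im p with im p
    ... | u , Uu , pg≈pu , g∼u =
      u , Uu , chain , ∼-respˡ g≈g' g∼u
      where
      chain : (p ^ g') ≈P (p ^ u)
      chain = begin
        p ^ g'  ≈⟨ ^-congʳ p g g' g≈g' ⟨
        p ^ g   ≈⟨ pg≈pu ⟩
        p ^ u   ∎

    has-·′ : ∀ {g g'} → Imitated U _∼_ g → Imitated U _∼_ g' → Imitated U _∼_ (g ·G g')
    has-·′ {g} {g'} im im' p with im' p
    ... | u' , Uu' , pg'≈pu' , g'∼u' with im (p ^ u')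
    ... | u , Uu , pu'g≈pu'u , g∼u = u ·G u' , has-· sU Uu Uu' , chain , ∼-· g∼u g'∼u'
      where
      chain : (p ^ (g ·G g')) ≈P (p ^ (u ·G u'))
      chain = begin
        p ^ (g ·G g')    ≈⟨ ^-· p g g' ⟩
        (p ^ g') ^ g     ≈⟨ ^-congˡ (p ^ g') (p ^ u') g pg'≈pu' ⟩
        (p ^ u') ^ g     ≈⟨ pu'g≈pu'u ⟩
        (p ^ u') ^ u     ≈⟨ ^-· p u u' ⟨
        p ^ (u ·G u')    ∎

    has-inv′ : ∀ {g} → Imitated U _∼_ g → Imitated U _∼_ (invG g)
    has-inv′ {g} im p with im (p ^ invG g)
    ... | u , Uu , e , g∼u = invG u , has-inv sU Uu , chain , ∼-inv g∼u
      where
      chain : (p ^ invG g) ≈P (p ^ invG u)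
      chain = begin
        p ^ invG g                      ≈⟨ ^-^-inv (p ^ invG g) u ⟨
        ((p ^ invG g) ^ u) ^ invG u     ≈⟨ ^-congˡ q ((p ^ invG g) ^ u) (invG u) e ⟨
        q ^ invG u                      ≈⟨ ^-congˡ q p (invG u) (^-inv-^ p g) ⟩
        p ^ invG u                      ∎
        where q = (p ^ invG g) ^ g

  _≈₂_ : Rel (G h n) 0ℓ
  g ≈₂ u = proj₂ g ≈ₚ proj₂ u

  ≈₂-isCompatible : IsCompatible _≈₂_
  ≈₂-isCompatible = record
    { ∼-respˡ = λ (_ , ψ≈ψ') ψ≈ψᵤ x → trans (sym (ψ≈ψ' x)) (ψ≈ψᵤ x)
    ; ∼-ε     = λ _ → refl
    ; ∼-·     = λ {_} {g'} {u} ψ≈ψᵤ ψ'≈ψᵤ' x →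
                  trans (ψ≈ψᵤ (proj₂ g' ⟨$⟩ʳ x)) (cong (proj₂ u ⟨$⟩ʳ_) (ψ'≈ψᵤ' x))
    ; ∼-inv   = λ {g} {u} → ⟨$⟩ˡ-cong (proj₂ g) (proj₂ u)
    }

  O′ : Sub 0ℓ h n → Sub 0ℓ h n
  O′ U = Imitated U _≈₂_

  module _ {U : Sub 0ℓ h n} where

    W≐Imitated : W U ≐ Imitated U (λ _ _ → ⊤)
    W≐Imitated = (λ g w p → let u , Uu , e = w p in u , Uu , e , tt)
               , (λ g w p → let u , Uu , e , _ = w p in u , Uu , e)

    W-isSubgroup : IsSubgroup U → IsSubgroup (W U)
    W-isSubgroup sU = IsSubgroup-≐ (swap W≐Imitated)
      (Imitated-isSubgroup sU record
        { ∼-respˡ = λ _ _ → tt ; ∼-ε = tt ; ∼-· = λ _ _ → tt ; ∼-inv = λ _ → tt })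

    W≤PU : W U ≤P U
    W≤PU p g w = w p

    O′⊆W : O′ U ⊆ W U
    O′⊆W g o p = let u , Uu , e , _ = o p in u , Uu , e

    U⊆O′ : U ⊆ O′ U
    U⊆O′ u Uu p = u , Uu , (λ _ _ → refl) , λ _ → refl

    O′-regular : Regular U → Regular (O′ U)
    O′-regular rU p g o pg≈p x =
      let u , Uu , pg≈pu , ψ≈ψᵤ = o p
      in trans (ψ≈ψᵤ x) (rU p u Uu (λ i y → trans (sym (pg≈pu i y)) (pg≈p i y)) x)

    𝒜⊆O′ : ∀ V → 𝒜 U V → V ⊆ O′ U
    𝒜⊆O′ V (sV , rV , U⊆V , V≤U) v Vv p =
      let u , Uu , pv≈pu = V≤U p v Vv
          k = invG u ·G v
          Vk : V k
          Vk = has-· (has-inv (U⊆V u Uu)) Vv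
          pk≈p : (p ^ k) ≈P p
          pk≈p = begin
            p ^ k                ≈⟨ ^-· p (invG u) v ⟩
            (p ^ v) ^ invG u     ≈⟨ ^-congˡ (p ^ v) (p ^ u) (invG u) pv≈pu ⟩
            (p ^ u) ^ invG u     ≈⟨ ^-^-inv p u ⟩
            p                    ∎
          ψ≈ψᵤ : v ≈₂ u
          ψ≈ψᵤ x = trans (sym (inverseʳ (proj₂ u))) (cong (proj₂ u ⟨$⟩ʳ_) (rV p k Vk pk≈p x))
      in u , Uu , pv≈pu , ψ≈ψᵤ
      where
      open IsSubgroup sV
      open SetoidReasoning ≈P-setoid

    module _ (sU : IsSubgroup U) (rU : Regular U) where

      O′∈𝒜 : 𝒜 U (O′ U)
      O′∈𝒜 = Imitated-isSubgroup sU ≈₂-isCompatible , O′-regular rU , U⊆O′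
           , ⊆-≤P-trans O′⊆W W≤PU

      O≐O′ : O U ≐ O′ U
      O≐O′ = Gen-least (Imitated-isSubgroup sU ≈₂-isCompatible) 𝒜⊆O′
           , λ g → base (O′ U) O′∈𝒜

      O⊆W : O U ⊆ W U
      O⊆W g o = O′⊆W g (proj₁ O≐O′ g o)

      U≅PO : U ≅P O U
      U≅PO = ⊆⇒≤P (λ u Uu → proj₂ O≐O′ u (U⊆O′ u Uu)) , ⊆-≤P-trans O⊆W W≤PU

      W-regular⇔W≐O : Regular (W U) ⇔ (W U ≐ O U)
      W-regular⇔W≐O = mk⇔
        (λ rW → (λ g → base (W U) (W-isSubgroup sU , rW , U⊆W , W≤PU)) , O⊆W)
        (λ (W⊆O , _) → Regular-⊆ (λ g w → proj₁ O≐O′ g (W⊆O g w)) (O′-regular rU))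
        where
        U⊆W : U ⊆ W U
        U⊆W u Uu = O′⊆W u (U⊆O′ u Uu)

W⊆Sh×id : ∀ {h n} {U : Sub 0ℓ (ℕ.suc h) n} → U ⊆ Sh×id → W U ⊆ Sh×id
W⊆Sh×id U⊆Sh×id g w x =
  let u , Uu , e = w (λ _ → idₚ) in trans (e 0F x) (U⊆Sh×id u Uu x)

id×S : ∀ {h n} → Sub 0ℓ h n
id×S g = proj₁ g ≈ₚ idₚ

id×S-isSubgroup : ∀ {h n} → IsSubgroup (id×S {h} {n})
id×S-isSubgroup = record
  { resp    = λ (φ≈φ' , _) φ≈id x → trans (sym (φ≈φ' x)) (φ≈id x)
  ; has-ε   = λ _ → refl
  ; has-·   = λ {g} φ≈id φ'≈id x → trans (cong (proj₁ g ⟨$⟩ʳ_) (φ'≈id x)) (φ≈id x)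
  ; has-inv = λ {g} → ⟨$⟩ˡ-cong (proj₁ g) idₚ
  }

id×S-regular : ∀ {h n} → Regular (id×S {ℕ.suc h} {n})
id×S-regular p (φ , ψ) φ≈id pg≈p y = begin
  ψ ⟨$⟩ʳ y                       ≡⟨ cong (ψ ⟨$⟩ʳ_) (inverseʳ (p 0F)) ⟨
  ψ ⟨$⟩ʳ (p 0F ⟨$⟩ʳ x)           ≡⟨ cong (λ i → ψ ⟨$⟩ʳ (p i ⟨$⟩ʳ x)) (⟨$⟩ˡ-cong φ idₚ φ≈id 0F) ⟨
  ψ ⟨$⟩ʳ (p (φ ⟨$⟩ˡ 0F) ⟨$⟩ʳ x)  ≡⟨ pg≈p 0F x ⟩
  p 0F ⟨$⟩ʳ x                    ≡⟨ inverseʳ (p 0F) ⟩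
  y                              ∎
  where
  open ≡-Reasoning
  x = p 0F ⟨$⟩ˡ y

τ : S 2
τ = transpose 0F 1F

perm₂ : Bool → S 2
perm₂ false = idₚ
perm₂ true  = τ

perm₂-surjective : (π : S 2) → Σ Bool λ b → π ≈ₚ perm₂ b
perm₂-surjective π with π ⟨$⟩ʳ 0F in e₀ | π ⟨$⟩ʳ 1F in e₁
... | 0F | 1F = false , λ { 0F → e₀ ; 1F → e₁ }
... | 1F | 0F = true  , λ { 0F → e₀ ; 1F → e₁ }
... | 0F | 0F = contradiction (⟨$⟩ʳ-injective π (trans e₀ (sym e₁))) λ ()
... | 1F | 1F = contradiction (⟨$⟩ʳ-injective π (trans e₀ (sym e₁))) λ ()

profile₂ : Bool → Bool → Profile 2 2
profile₂ b c 0F = perm₂ b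
profile₂ b c 1F = perm₂ c

profile₂-surjective : (p : Profile 2 2) → Σ Bool λ b → Σ Bool λ c → p ≈P profile₂ b c
profile₂-surjective p =
  let b , p₀≈b = perm₂-surjective (p 0F)
      c , p₁≈c = perm₂-surjective (p 1F)
  in b , c , λ { 0F → p₀≈b ; 1F → p₁≈c }

swap₂ : G 2 2
swap₂ = τ , τ

-- Two equal ballots are only permuted among themselves, so swapping the alternatives imitates
-- swap₂; two different ballots are exchanged by swap₂, so the identity does.
swap₂-imitator : Bool → Bool → S 2
swap₂-imitator false false = τ
swap₂-imitator true  true  = τ
swap₂-imitator false true  = idₚ
swap₂-imitator true  false = idₚ

swap₂-imitator-correct :
  ∀ b c → (profile₂ b c ^ swap₂) ≈P (profile₂ b c ^ (idₚ , swap₂-imitator b c))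
swap₂-imitator-correct b c = toWitness (decided b c)
  where
  decided :
    ∀ b c → True ((profile₂ b c ^ swap₂) ≈P? (profile₂ b c ^ (idₚ , swap₂-imitator b c)))
  decided false false = tt
  decided true  true  = tt
  decided false true  = tt
  decided true  false = tt

swap₂∈W : W id×S swap₂
swap₂∈W p =
  let b , c , p≈q = profile₂-surjective p
      u = idₚ , swap₂-imitator b c
  in u , (λ _ → refl)
   , ^-≈P-transport p (profile₂ b c) swap₂ u p≈q (swap₂-imitator-correct b c)

swap₂-fixes-profile₂ : (profile₂ false true ^ swap₂) ≈P profile₂ false true
swap₂-fixes-profile₂ = toWitness {a? = (profile₂ false true ^ swap₂) ≈P? profile₂ false true} tt

W-id×S-not-regular : ¬ Regular (W (id×S {2} {2}))
W-id×S-not-regular rW =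
  contradiction (rW (profile₂ false true) swap₂ swap₂∈W swap₂-fixes-profile₂ 0F) λ ()

proposition54 :
    (∀ (h n : ℕ) → 2 ≤ h → 2 ≤ n → (U : Sub 0ℓ h n) → IsSubgroup U → Regular U →
      ((O U ⊆ W U) × IsSubgroup (W U))
      × (Regular (W U) ⇔ (W U ≐ O U))
      × (U ≅P O U)
      × (U ⊆ Sh×id → (W U ⊆ Sh×id) × (W U ≐ O U)))
    × (Σ ℕ λ h → Σ ℕ λ n → 2 ≤ h × 2 ≤ n ×
        Σ (Sub 0ℓ h n) λ U → IsSubgroup U × Regular U × ¬ Regular (W U))
proposition54 =
    (λ { (ℕ.suc _) _ _ _ _ sU rU →
           (O⊆W sU rU , W-isSubgroup sU) , W-regular⇔W≐O sU rU , U≅PO sU rU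
         , λ U⊆Sh×id → W⊆Sh×id U⊆Sh×id
                     , Equivalence.to (W-regular⇔W≐O sU rU)
                         (Regular-⊆ (W⊆Sh×id U⊆Sh×id) Sh×id-regular) })
  , 2 , 2 , 2≤2 , 2≤2 , id×S , id×S-isSubgroup , id×S-regular , W-id×S-not-regular
  where
  2≤2 : 2 ≤ 2
  2≤2 = s≤s (s≤s z≤n)
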